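{- Let $f$ be a monotone unary function on $\mathbb{N}$ with $f(x)\ge x$ for all $x$, and let $n\ge 1$. Then $G_n$ is monotone and $G_n(x)\ge x$ for all $x$.
   Context: With $N_k(x)=k\cdot(f(x)-1)$, define $G_1(x)=f(x)+x$ and $G_{k+1}(x)=G_k^{N_{k+1}(x)}(x+1)$, where $g^p$ denotes $p$-fold iteration of $g$. -}

module Defs where

open import Data.Nat using (ℕ; zero; suc; _+_; _*_; _∸_; _≤_)

iter : (ℕ → ℕ) → ℕ → ℕ → ℕ
iter g zero x = x
iter g (suc p) x = g (iter g p x)

N : (ℕ → ℕ) → ℕ → ℕ → ℕ
N f k x = k * (f x ∸ 1)

-- G f n for n ≥ 1 is G_n; G f 0 is an unused junk value (taken to be f x + x).
-- G_1(x) = f(x) + x ;  G_{k+1}(x) = (G_k)^{N_{k+1}(x)} (x + 1)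
G : (ℕ → ℕ) → ℕ → ℕ → ℕ
G f zero x = f x + x
G f (suc zero) x = f x + x
G f (suc (suc k)) x = iter (G f (suc k)) (N f (suc (suc k)) x) (x + 1)

Monotone : (ℕ → ℕ) → Set
Monotone g = ∀ {x y} → x ≤ y → g x ≤ g y

module Submission where

-- Call g : ℕ → ℕ *inflationary* if x ≤ g x for all x.  For a
-- monotone inflationary H the iterate H^p(x) is monotone jointly in the
-- number of steps p and the starting point x: raising x helps because H
-- is monotone, and extra steps help because H is inflationary.  Since
-- N_{k+1} is monotone whenever f is, G_{k+1}(x) = G_k^{N_{k+1}(x)}(x+1) is
-- then monotone in x, and it is inflationary because x ≤ x + 1 ≤ G_k^p(x+1).

open import Defs
open import Data.Nat using (ℕ; zero; suc; _+_; _*_; _∸_; _≤_; s≤s)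
open import Data.Nat.Properties
  using (≤-refl; ≤-trans; +-mono-≤; +-monoˡ-≤; *-monoʳ-≤; ∸-monoˡ-≤; m≤m+n; m≤n+m)
open import Data.Product using (_×_; _,_)

Inflationary : (ℕ → ℕ) → Set
Inflationary g = ∀ x → x ≤ g x

iter-mono : ∀ {H} → Monotone H → ∀ p → Monotone (iter H p)
iter-mono hm zero    x≤y = x≤y
iter-mono hm (suc p) x≤y = hm (iter-mono hm p x≤y)

iter-infl : ∀ {H} → Inflationary H → ∀ p → Inflationary (iter H p)
iter-infl hi zero    z = ≤-refl
iter-infl hi (suc p) z = ≤-trans (iter-infl hi p z) (hi _)

-- For monotone inflationary H, more iteration steps give a larger value:
-- H^p(z) ≤ H^(q-p)(H^p(z)) = H^q(z), proved by peeling off common steps.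
iter-steps : ∀ {H} → Monotone H → Inflationary H →
             ∀ {p q} z → p ≤ q → iter H p z ≤ iter H q z
iter-steps hm hi {zero}  {q}     z _         = iter-infl hi q z
iter-steps hm hi {suc p} {suc q} z (s≤s p≤q) = hm (iter-steps hm hi z p≤q)

iter-mono₂ : ∀ {H} → Monotone H → Inflationary H →
             ∀ {p q y z} → p ≤ q → y ≤ z → iter H p y ≤ iter H q z
iter-mono₂ hm hi {p} p≤q y≤z =
  ≤-trans (iter-mono hm p y≤z) (iter-steps hm hi _ p≤q)

N-mono : ∀ {f} → Monotone f → ∀ k → Monotone (N f k)
N-mono fm k x≤y = *-monoʳ-≤ k (∸-monoˡ-≤ 1 (fm x≤y))

MonoInfl : (ℕ → ℕ) → Set
MonoInfl g = Monotone g × Inflationary g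

G-step : ∀ {f} → Monotone f → ∀ k →
         MonoInfl (G f (suc k)) → MonoInfl (G f (suc (suc k)))
G-step {f} fm k (hm , hi) = mono , infl
  where
  mono : Monotone (G f (suc (suc k)))
  mono x≤y = iter-mono₂ hm hi (N-mono fm (suc (suc k)) x≤y) (+-monoˡ-≤ 1 x≤y)

  infl : Inflationary (G f (suc (suc k)))
  infl x = ≤-trans (m≤m+n x 1) (iter-infl hi (N f (suc (suc k)) x) (x + 1))

G-monoInfl : ∀ {f} → Monotone f → ∀ k → MonoInfl (G f (suc k))
G-monoInfl {f} fm zero    = (λ x≤y → +-mono-≤ (fm x≤y) x≤y) , (λ x → m≤n+m x (f x))
G-monoInfl     fm (suc k) = G-step fm k (G-monoInfl fm k)

lemma6 : (f : ℕ → ℕ) → Monotone f → (∀ x → x ≤ f x) →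
         (n : ℕ) → 1 ≤ n → Monotone (G f n) × (∀ x → x ≤ G f n x)
lemma6 f fm _ (suc k) _ = G-monoInfl fm k
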